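{- Over ${\mathsf{PRA}^2}$, $\mathrm{I}\Sigma^0_1$ does not imply $\Delta^0_1\text{ - }\mathrm{CA}$.
   Context: ${\mathsf{PRA}^2}$ is the two-sorted theory with number variables and (total) function variables, with symbols $0$, $s$, $<$ and a symbol for each primitive recursive function; its axioms are the successor axioms, the defining equations of all primitive recursive functions, the defining equations of all primitive recursive functionals of type 2 (functions are closed under every scheme primitive recursive relative to function arguments), and quantifier-free induction with number and function parameters. $\Sigma^0_n,\Pi^0_n$ formulas may contain function parameters. $\Delta^0_1\text{ - }\mathrm{CA}$: if $\forall n(\varphi(n)\leftrightarrow\psi(n))$ with $\varphi\in\Sigma^0_1$, $\psi\in\Pi^0_1$, then there is $f$ with $\forall n[(\varphi(n)\to f(n)=1)\wedge(\neg\varphi(n)\to f(n)=0)]$. $\mathrm{I}\Sigma^0_1$ is the induction scheme for $\Sigma^0_1$ formulas with parameters. -}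

module Defs where

open import Data.Nat using (ℕ; zero; suc)
open import Data.Fin using (Fin; zero; suc)
open import Data.Vec using (Vec; []; _∷_; lookup; map)

-- Codes for the primitive recursive functionals of type 2
-- (Kleene's schemes, primitive recursive relative to function arguments).
-- PRF k j : k number arguments, j function arguments, number value.

data PRF : ℕ → ℕ → Set where
  Zc : ∀ {j} → PRF 0 j
  Sc : ∀ {j} → PRF 1 j
  Pc : ∀ {k j} → Fin k → PRF k j
  Ac : ∀ {j} → Fin j → PRF 1 j
  Cc : ∀ {k l j} → PRF l j → Vec (PRF k j) l → PRF k j
  Rc : ∀ {k j} → PRF k j → PRF (suc (suc k)) j → PRF (suc k) j

-- Two-sorted language (de Bruijn indices).
-- Tm n m : number terms with n number variables and m function variables.
-- Function terms are just function variables (Fin m).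

data Tm (n m : ℕ) : Set where
  var : Fin n → Tm n m
  zer : Tm n m
  sc  : Tm n m → Tm n m
  ap  : Fin m → Tm n m → Tm n m
  pr  : ∀ {k j} → PRF k j → Vec (Tm n m) k → Vec (Fin m) j → Tm n m

mutual
  subT : ∀ {n n' m} → (Fin n → Tm n' m) → Tm n m → Tm n' m
  subT σ (var i) = σ i
  subT σ zer = zer
  subT σ (sc t) = sc (subT σ t)
  subT σ (ap a t) = ap a (subT σ t)
  subT σ (pr f ts as) = pr f (subTs σ ts) as

  subTs : ∀ {n n' m k} → (Fin n → Tm n' m) → Vec (Tm n m) k → Vec (Tm n' m) k
  subTs σ [] = []
  subTs σ (t ∷ ts) = subT σ t ∷ subTs σ ts

mutual
  renFT : ∀ {n m m'} → (Fin m → Fin m') → Tm n m → Tm n m'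
  renFT ρ (var i) = var i
  renFT ρ zer = zer
  renFT ρ (sc t) = sc (renFT ρ t)
  renFT ρ (ap a t) = ap (ρ a) (renFT ρ t)
  renFT ρ (pr f ts as) = pr f (renFTs ρ ts) (map ρ as)

  renFTs : ∀ {n m m' k} → (Fin m → Fin m') → Vec (Tm n m) k → Vec (Tm n m') k
  renFTs ρ [] = []
  renFTs ρ (t ∷ ts) = renFT ρ t ∷ renFTs ρ ts

wkNT : ∀ {n m} → Tm n m → Tm (suc n) m
wkNT = subT (λ i → var (suc i))

wkNTs : ∀ {n m k} → Vec (Tm n m) k → Vec (Tm (suc n) m) k
wkNTs = subTs (λ i → var (suc i))

data Fm (n m : ℕ) : Set where
  _≐_ : Tm n m → Tm n m → Fm n m
  _≺_ : Tm n m → Tm n m → Fm n m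
  ⊥f  : Fm n m
  _⇒_ : Fm n m → Fm n m → Fm n m
  ∀N  : Fm (suc n) m → Fm n m
  ∀F  : Fm n (suc m) → Fm n m

infix 6 _≐_ _≺_
infixr 4 _⇒_
infixr 5 _∧f_ _∨f_
infix 4 _⇔_
infix 7 ¬f_

liftN : ∀ {n n' m} → (Fin n → Tm n' m) → Fin (suc n) → Tm (suc n') m
liftN σ zero = var zero
liftN σ (suc i) = wkNT (σ i)

liftF : ∀ {m m'} → (Fin m → Fin m') → Fin (suc m) → Fin (suc m')
liftF ρ zero = zero
liftF ρ (suc i) = suc (ρ i)

subF : ∀ {n n' m} → (Fin n → Tm n' m) → Fm n m → Fm n' m
subF σ (t ≐ u) = subT σ t ≐ subT σ u
subF σ (t ≺ u) = subT σ t ≺ subT σ u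
subF σ ⊥f = ⊥f
subF σ (φ ⇒ ψ) = subF σ φ ⇒ subF σ ψ
subF σ (∀N φ) = ∀N (subF (liftN σ) φ)
subF σ (∀F φ) = ∀F (subF (λ i → renFT suc (σ i)) φ)

renF : ∀ {n m m'} → (Fin m → Fin m') → Fm n m → Fm n m'
renF ρ (t ≐ u) = renFT ρ t ≐ renFT ρ u
renF ρ (t ≺ u) = renFT ρ t ≺ renFT ρ u
renF ρ ⊥f = ⊥f
renF ρ (φ ⇒ ψ) = renF ρ φ ⇒ renF ρ ψ
renF ρ (∀N φ) = ∀N (renF ρ φ)
renF ρ (∀F φ) = ∀F (renF (liftF ρ) φ)

wkN : ∀ {n m} → Fm n m → Fm (suc n) m
wkN = subF (λ i → var (suc i))

wkF : ∀ {n m} → Fm n m → Fm n (suc m)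
wkF = renF suc

_/N0 : ∀ {n m} → Tm n m → Fin (suc n) → Tm n m
(t /N0) zero = t
(t /N0) (suc i) = var i

_/F0 : ∀ {m} → Fin m → Fin (suc m) → Fin m
(a /F0) zero = a
(a /F0) (suc i) = i

¬f_ : ∀ {n m} → Fm n m → Fm n m
¬f φ = φ ⇒ ⊥f

_∧f_ : ∀ {n m} → Fm n m → Fm n m → Fm n m
φ ∧f ψ = ¬f (φ ⇒ ¬f ψ)

_∨f_ : ∀ {n m} → Fm n m → Fm n m → Fm n m
φ ∨f ψ = ¬f φ ⇒ ψ

_⇔_ : ∀ {n m} → Fm n m → Fm n m → Fm n m
φ ⇔ ψ = (φ ⇒ ψ) ∧f (ψ ⇒ φ)

∃N : ∀ {n m} → Fm (suc n) m → Fm n m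
∃N φ = ¬f ∀N (¬f φ)

∃F : ∀ {n m} → Fm n (suc m) → Fm n m
∃F φ = ¬f ∀F (¬f φ)

one : ∀ {n m} → Tm n m
one = sc zer

data QF {n m : ℕ} : Fm n m → Set where
  qf-eq  : ∀ t u → QF (t ≐ u)
  qf-lt  : ∀ t u → QF (t ≺ u)
  qf-⊥   : QF ⊥f
  qf-imp : ∀ {φ ψ} → QF φ → QF ψ → QF (φ ⇒ ψ)

-- Σ⁰₀: bounded quantifiers only (∀x<t θ; bounded ∃ is ¬∀x<t¬)
data Σ⁰₀ {n m : ℕ} : Fm n m → Set where
  d-eq  : ∀ t u → Σ⁰₀ (t ≐ u)
  d-lt  : ∀ t u → Σ⁰₀ (t ≺ u)
  d-⊥   : Σ⁰₀ ⊥f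
  d-imp : ∀ {φ ψ} → Σ⁰₀ φ → Σ⁰₀ ψ → Σ⁰₀ (φ ⇒ ψ)
  d-ball : ∀ (t : Tm n m) {θ : Fm (suc n) m} → Σ⁰₀ θ → Σ⁰₀ (∀N ((var zero ≺ wkNT t) ⇒ θ))

data Σ⁰₁ {n m : ℕ} : Fm n m → Set where
  sig : ∀ {θ : Fm (suc n) m} → Σ⁰₀ θ → Σ⁰₁ (∃N θ)

data Π⁰₁ {n m : ℕ} : Fm n m → Set where
  pi : ∀ {θ : Fm (suc n) m} → Σ⁰₀ θ → Π⁰₁ (∀N θ)

zero/0 : ∀ {n m} → Fin (suc n) → Tm n m
zero/0 = zer /N0

succ/0 : ∀ {n m} → Fin (suc n) → Tm (suc n) m
succ/0 zero = sc (var zero)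
succ/0 (suc i) = var (suc i)

Ind : ∀ {n m} → Fm (suc n) m → Fm n m
Ind φ = subF zero/0 φ ⇒ ∀N (φ ⇒ subF succ/0 φ) ⇒ ∀N φ

Δ⁰₁-CA : ∀ {n m} → Fm (suc n) m → Fm (suc n) m → Fm n m
Δ⁰₁-CA φ ψ =
  ∀N (φ ⇔ ψ) ⇒
  ∃F (∀N ((wkF φ ⇒ ap zero (var zero) ≐ one) ∧f (¬f wkF φ ⇒ ap zero (var zero) ≐ zer)))

-- The theory PRA² + IΣ⁰₁ (axioms with free variables, in every context)

data PRA²+IΣ⁰₁ {n m : ℕ} : Fm n m → Set where
  succ≠0  : ∀ t → PRA²+IΣ⁰₁ (¬f (sc t ≐ zer))
  succ-inj : ∀ t u → PRA²+IΣ⁰₁ (sc t ≐ sc u ⇒ t ≐ u)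
  lt-zero : ∀ t → PRA²+IΣ⁰₁ (¬f (t ≺ zer))
  lt-succ : ∀ t u → PRA²+IΣ⁰₁ (t ≺ sc u ⇔ (t ≺ u ∨f t ≐ u))
  eq-Z : ∀ {j} (as : Vec (Fin m) j) → PRA²+IΣ⁰₁ (pr Zc [] as ≐ zer)
  eq-S : ∀ {j} t (as : Vec (Fin m) j) → PRA²+IΣ⁰₁ (pr Sc (t ∷ []) as ≐ sc t)
  eq-P : ∀ {k j} (i : Fin k) ts (as : Vec (Fin m) j) → PRA²+IΣ⁰₁ (pr (Pc i) ts as ≐ lookup ts i)
  eq-A : ∀ {j} (i : Fin j) t (as : Vec (Fin m) j) →
         PRA²+IΣ⁰₁ (pr (Ac i) (t ∷ []) as ≐ ap (lookup as i) t)
  eq-C : ∀ {k l j} (g : PRF l j) (hs : Vec (PRF k j) l) ts (as : Vec (Fin m) j) →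
         PRA²+IΣ⁰₁ (pr (Cc g hs) ts as ≐ pr g (map (λ h → pr h ts as) hs) as)
  eq-R0 : ∀ {k j} (g : PRF k j) h ts (as : Vec (Fin m) j) →
          PRA²+IΣ⁰₁ (pr (Rc g h) (zer ∷ ts) as ≐ pr g ts as)
  eq-RS : ∀ {k j} (g : PRF k j) h t ts (as : Vec (Fin m) j) →
          PRA²+IΣ⁰₁ (pr (Rc g h) (sc t ∷ ts) as ≐ pr h (t ∷ pr (Rc g h) (t ∷ ts) as ∷ ts) as)
  -- closure of the functions under the functionals:  ∃β ∀x β(x) = F(x, t⃗, α⃗)
  fun-closure : ∀ {k j} (f : PRF (suc k) j) (ts : Vec (Tm n m) k) (as : Vec (Fin m) j) →
    PRA²+IΣ⁰₁ (∃F (∀N (ap zero (var zero) ≐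
                        pr f (var zero ∷ wkNTs (renFTs suc ts)) (map suc as))))
  qf-ind : ∀ {φ : Fm (suc n) m} → QF φ → PRA²+IΣ⁰₁ (Ind φ)
  Σ⁰₁-ind : ∀ {φ : Fm (suc n) m} → Σ⁰₁ φ → PRA²+IΣ⁰₁ (Ind φ)

Theory : Set₁
Theory = ∀ {n m} → Fm n m → Set

infix 2 _⊢_

data _⊢_ (T : Theory) : {n m : ℕ} → Fm n m → Set where
  ax  : ∀ {n m} {φ : Fm n m} → T φ → T ⊢ φ
  K   : ∀ {n m} {φ ψ : Fm n m} → T ⊢ φ ⇒ ψ ⇒ φ
  S   : ∀ {n m} {φ ψ χ : Fm n m} → T ⊢ (φ ⇒ ψ ⇒ χ) ⇒ (φ ⇒ ψ) ⇒ φ ⇒ χ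
  DN  : ∀ {n m} {φ : Fm n m} → T ⊢ ¬f ¬f φ ⇒ φ
  mp  : ∀ {n m} {φ ψ : Fm n m} → T ⊢ φ ⇒ ψ → T ⊢ φ → T ⊢ ψ
  ∀N-elim  : ∀ {n m} {φ : Fm (suc n) m} (t : Tm n m) → T ⊢ ∀N φ ⇒ subF (t /N0) φ
  ∀N-intro : ∀ {n m} {ψ : Fm n m} {φ : Fm (suc n) m} → T ⊢ wkN ψ ⇒ φ → T ⊢ ψ ⇒ ∀N φ
  ∀F-elim  : ∀ {n m} {φ : Fm n (suc m)} (a : Fin m) → T ⊢ ∀F φ ⇒ renF (a /F0) φ
  ∀F-intro : ∀ {n m} {ψ : Fm n m} {φ : Fm n (suc m)} → T ⊢ wkF ψ ⇒ φ → T ⊢ ψ ⇒ ∀F φ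
  eq-refl  : ∀ {n m} (t : Tm n m) → T ⊢ t ≐ t
  eq-subst : ∀ {n m} {φ : Fm (suc n) m} (t u : Tm n m) →
             T ⊢ t ≐ u ⇒ subF (t /N0) φ ⇒ subF (u /N0) φ

module Submission where

-- An ω-model of PRA² + IΣ⁰₁ is given by the standard numbers together with the functions
-- primitive recursive in one oracle α; induction holds for every formula because the
-- number sort is standard.  Enumerate the codes of these functions as enum 0, enum 1, … and
-- let D = {x | (enum x)(x) = 0}.  The oracle is built in stages: stage n = ⟨x, s⟩ runs
-- enum x on x, consulting only the values α 0, …, α (n − 1), and if the run finishes it
-- records 2x+1 (result 0) or 2x+2 (nonzero result).  Every run finishes at some stage, so
-- D = {x | ∃n α(n) = 2x+1} = {x | ∀n α(n) ≠ 2x+2} is Δ⁰₁ in the model; but it has no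
-- characteristic function there, since such a function would be some enum x and would
-- disagree with D at x.

open import Defs
open import Data.Nat using (ℕ; zero; suc; _+_; _*_; _≤_; _<_; _⊔_; z≤n; s≤s; _≟_; _<?_)
open import Data.Nat.Properties
  using ( suc-injective; +-identityʳ; +-comm; +-suc; *-cancelˡ-≡; even≢odd; 0≢1+n
        ; ≤-refl; ≤-trans; ≤-pred; <-≤-trans; ≤-<-trans; <⇒≱; <-cmp; n<1+n; m<n⇒m<1+n
        ; m<1+n⇒m<n∨m≡n; m≤m+n; m≤n+m; +-monoˡ-≤; m≤m⊔n; m≤n⊔m )
open import Data.Nat.DivMod using (_mod_; m<n⇒m%n≡m)
open import Data.Fin using (Fin; zero; suc; toℕ)
open import Data.Fin.Properties using (toℕ-injective; toℕ-fromℕ<; toℕ<n)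
open import Data.Vec using (Vec; []; _∷_; lookup; map)
open import Data.Vec.Properties using (lookup-map; map-∘; map-cong)
open import Data.Vec.Functional using (Vector) renaming ([] to []ᶠ; _∷_ to _∷ᶠ_)
open import Data.Maybe using (Maybe; just; nothing; _>>=_)
open import Data.Maybe.Properties using (just-injective)
open import Data.Product using (∃; _×_; _,_; proj₁; proj₂)
open import Data.Sum using (inj₁; inj₂)
open import Data.Empty using (⊥; ⊥-elim)
open import Function using (_∘_; id)
open import Function.Bundles using (mk⇔; Equivalence) renaming (_⇔_ to _⟺_)
open import Function.Construct.Identity using (⇔-id)
open import Function.Related.TypeIsomorphisms using (→-cong-⇔)
open import Relation.Binary.Definitions using (tri<; tri≈; tri>)
open import Relation.Nullary using (¬_; yes; no)
open import Relation.Nullary.Decidable using (decidable-stable)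
open import Relation.Binary.PropositionalEquality

open Equivalence using (to; from)

variable
  k j l n n′ m m′ : ℕ

mutual
  eval : PRF k j → Vec ℕ k → Vec (ℕ → ℕ) j → ℕ
  eval Zc        []       fs = 0
  eval Sc        (x ∷ []) fs = suc x
  eval (Pc i)    xs       fs = lookup xs i
  eval (Ac i)    (x ∷ []) fs = lookup fs i x
  eval (Cc g hs) xs       fs = eval g (evalAll hs xs fs) fs
  eval (Rc g h)  (x ∷ xs) fs = evalRec g h x xs fs

  evalRec : PRF k j → PRF (suc (suc k)) j → ℕ → Vec ℕ k → Vec (ℕ → ℕ) j → ℕ
  evalRec g h zero    xs fs = eval g xs fs
  evalRec g h (suc x) xs fs = eval h (x ∷ evalRec g h x xs fs ∷ xs) fs

  evalAll : Vec (PRF k j) l → Vec ℕ k → Vec (ℕ → ℕ) j → Vec ℕ l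
  evalAll []       xs fs = []
  evalAll (h ∷ hs) xs fs = eval h xs fs ∷ evalAll hs xs fs

PartialOracle : Set
PartialOracle = ℕ → Maybe ℕ

mutual
  evalPartial : PRF k 1 → Vec ℕ k → PartialOracle → Maybe ℕ
  evalPartial Zc        []       o = just 0
  evalPartial Sc        (x ∷ []) o = just (suc x)
  evalPartial (Pc i)    xs       o = just (lookup xs i)
  evalPartial (Ac zero) (x ∷ []) o = o x
  evalPartial (Cc g hs) xs       o = evalAllPartial hs xs o >>= λ ys → evalPartial g ys o
  evalPartial (Rc g h)  (x ∷ xs) o = evalRecPartial g h x xs o

  evalRecPartial : PRF k 1 → PRF (suc (suc k)) 1 → ℕ → Vec ℕ k → PartialOracle → Maybe ℕ
  evalRecPartial g h zero    xs o = evalPartial g xs o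
  evalRecPartial g h (suc x) xs o = evalRecPartial g h x xs o >>= λ r → evalPartial h (x ∷ r ∷ xs) o

  evalAllPartial : Vec (PRF k 1) l → Vec ℕ k → PartialOracle → Maybe (Vec ℕ l)
  evalAllPartial []       xs o = just []
  evalAllPartial (h ∷ hs) xs o = evalPartial h xs o >>= λ y → evalAllPartial hs xs o >>= λ ys → just (y ∷ ys)

module _ (β : ℕ → ℕ) where

  Approximates : PartialOracle → Set
  Approximates o = ∀ {m w} → o m ≡ just w → β m ≡ w

  DefinedBelow : ℕ → PartialOracle → Set
  DefinedBelow M o = ∀ {m} → m < M → o m ≡ just (β m)

  mutual
    evalPartial-sound : ∀ {o v} → Approximates o → (e : PRF k 1) (xs : Vec ℕ k) →
                        evalPartial e xs o ≡ just v → eval e xs (β ∷ []) ≡ v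
    evalPartial-sound o⊑β Zc        []       refl = refl
    evalPartial-sound o⊑β Sc        (x ∷ []) refl = refl
    evalPartial-sound o⊑β (Pc i)    xs       refl = refl
    evalPartial-sound o⊑β (Ac zero) (x ∷ []) ok   = o⊑β ok
    evalPartial-sound {o = o} o⊑β (Cc g hs) xs ok with evalAllPartial hs xs o in args
    ... | just ys =
      trans (cong (λ zs → eval g zs (β ∷ [])) (evalAllPartial-sound o⊑β hs xs args))
            (evalPartial-sound o⊑β g ys ok)
    evalPartial-sound o⊑β (Rc g h)  (x ∷ xs) ok   = evalRecPartial-sound o⊑β g h x xs ok

    evalRecPartial-sound : ∀ {o v} → Approximates o →
                           (g : PRF k 1) (h : PRF (suc (suc k)) 1) (x : ℕ) (xs : Vec ℕ k) →
                           evalRecPartial g h x xs o ≡ just v → evalRec g h x xs (β ∷ []) ≡ v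
    evalRecPartial-sound o⊑β g h zero    xs ok = evalPartial-sound o⊑β g xs ok
    evalRecPartial-sound {o = o} o⊑β g h (suc x) xs ok with evalRecPartial g h x xs o in prev
    ... | just r =
      trans (cong (λ z → eval h (x ∷ z ∷ xs) (β ∷ [])) (evalRecPartial-sound o⊑β g h x xs prev))
            (evalPartial-sound o⊑β h _ ok)

    evalAllPartial-sound : ∀ {o vs} → Approximates o → (hs : Vec (PRF k 1) l) (xs : Vec ℕ k) →
                           evalAllPartial hs xs o ≡ just vs → evalAll hs xs (β ∷ []) ≡ vs
    evalAllPartial-sound o⊑β [] xs refl = refl
    evalAllPartial-sound {o = o} o⊑β (h ∷ hs) xs ok
      with evalPartial h xs o in first | evalAllPartial hs xs o in rest
    evalAllPartial-sound o⊑β (h ∷ hs) xs refl | just y | just ys =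
      cong₂ _∷_ (evalPartial-sound o⊑β h xs first) (evalAllPartial-sound o⊑β hs xs rest)

  DefinedBelow-mono : ∀ {M M′ o} → M ≤ M′ → DefinedBelow M′ o → DefinedBelow M o
  DefinedBelow-mono M≤M′ defined m<M = defined (<-≤-trans m<M M≤M′)

  DefinedBelow-⊔ˡ : ∀ M₁ M₂ {o} → DefinedBelow (M₁ ⊔ M₂) o → DefinedBelow M₁ o
  DefinedBelow-⊔ˡ M₁ M₂ = DefinedBelow-mono (m≤m⊔n M₁ M₂)

  DefinedBelow-⊔ʳ : ∀ M₁ M₂ {o} → DefinedBelow (M₁ ⊔ M₂) o → DefinedBelow M₂ o
  DefinedBelow-⊔ʳ M₁ M₂ = DefinedBelow-mono (m≤n⊔m M₁ M₂)

  mutual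
    evalPartial-use : (e : PRF k 1) (xs : Vec ℕ k) →
                      ∃ λ M → ∀ {o} → DefinedBelow M o → evalPartial e xs o ≡ just (eval e xs (β ∷ []))
    evalPartial-use Zc        []       = 0 , λ _ → refl
    evalPartial-use Sc        (x ∷ []) = 0 , λ _ → refl
    evalPartial-use (Pc i)    xs       = 0 , λ _ → refl
    evalPartial-use (Ac zero) (x ∷ []) = suc x , λ defined → defined ≤-refl
    evalPartial-use (Cc g hs) xs
      with evalAllPartial-use hs xs | evalPartial-use g (evalAll hs xs (β ∷ []))
    ... | M₁ , use₁ | M₂ , use₂ = M₁ ⊔ M₂ , λ defined →
      trans (cong (_>>= λ ys → evalPartial g ys _) (use₁ (DefinedBelow-⊔ˡ M₁ M₂ defined)))
            (use₂ (DefinedBelow-⊔ʳ M₁ M₂ defined))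
    evalPartial-use (Rc g h)  (x ∷ xs) = evalRecPartial-use g h x xs

    evalRecPartial-use : (g : PRF k 1) (h : PRF (suc (suc k)) 1) (x : ℕ) (xs : Vec ℕ k) →
                         ∃ λ M → ∀ {o} → DefinedBelow M o →
                                 evalRecPartial g h x xs o ≡ just (evalRec g h x xs (β ∷ []))
    evalRecPartial-use g h zero    xs = evalPartial-use g xs
    evalRecPartial-use g h (suc x) xs
      with evalRecPartial-use g h x xs | evalPartial-use h (x ∷ evalRec g h x xs (β ∷ []) ∷ xs)
    ... | M₁ , use₁ | M₂ , use₂ = M₁ ⊔ M₂ , λ defined →
      trans (cong (_>>= λ r → evalPartial h (x ∷ r ∷ xs) _) (use₁ (DefinedBelow-⊔ˡ M₁ M₂ defined)))
            (use₂ (DefinedBelow-⊔ʳ M₁ M₂ defined))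

    evalAllPartial-use : (hs : Vec (PRF k 1) l) (xs : Vec ℕ k) →
                         ∃ λ M → ∀ {o} → DefinedBelow M o →
                                 evalAllPartial hs xs o ≡ just (evalAll hs xs (β ∷ []))
    evalAllPartial-use []       xs = 0 , λ _ → refl
    evalAllPartial-use (h ∷ hs) xs with evalPartial-use h xs | evalAllPartial-use hs xs
    ... | M₁ , use₁ | M₂ , use₂ = M₁ ⊔ M₂ , λ {o} defined →
      trans (cong (_>>= λ y → evalAllPartial hs xs o >>= λ ys → just (y ∷ ys))
                  (use₁ (DefinedBelow-⊔ˡ M₁ M₂ defined)))
            (cong (_>>= λ ys → just (eval h xs (β ∷ []) ∷ ys)) (use₂ (DefinedBelow-⊔ʳ M₁ M₂ defined)))

-- unpair walks through ℕ × ℕ along the anti-diagonals a + b = d, and pair is its inverse.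
triangle : ℕ → ℕ
triangle zero    = 0
triangle (suc d) = suc d + triangle d

pair : ℕ → ℕ → ℕ
pair a b = triangle (a + b) + b

next : ℕ × ℕ → ℕ × ℕ
next (zero  , b) = suc b , 0
next (suc a , b) = a , suc b

unpair : ℕ → ℕ × ℕ
unpair zero    = 0 , 0
unpair (suc n) = next (unpair n)

pair-suc-zero : ∀ b → pair (suc b) 0 ≡ suc (pair 0 b)
pair-suc-zero b = begin
  triangle (suc b + 0) + 0 ≡⟨ +-identityʳ _ ⟩
  triangle (suc b + 0)     ≡⟨ cong triangle (+-identityʳ (suc b)) ⟩
  suc (b + triangle b)     ≡⟨ cong suc (+-comm b (triangle b)) ⟩
  suc (triangle b + b)     ∎
  where open ≡-Reasoning

pair-zero-suc : ∀ a b → pair a (suc b) ≡ suc (pair (suc a) b)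
pair-zero-suc a b = begin
  triangle (a + suc b) + suc b   ≡⟨ cong (λ d → triangle d + suc b) (+-suc a b) ⟩
  triangle (suc a + b) + suc b   ≡⟨ +-suc _ b ⟩
  suc (triangle (suc a + b) + b) ∎
  where open ≡-Reasoning

unpair-pair : ∀ a b → unpair (pair a b) ≡ (a , b)
unpair-pair a b = go (a + b) a b refl
  where
  go : ∀ d a b → a + b ≡ d → unpair (pair a b) ≡ (a , b)
  go d       zero    zero    _   = refl
  go (suc d) (suc a) zero    a+0≡d = trans (cong unpair (pair-suc-zero a))
    (cong next (go d zero a (suc-injective (trans (sym (+-identityʳ (suc a))) a+0≡d))))
  go d       a       (suc b) a+b≡d = trans (cong unpair (pair-zero-suc a b))
    (cong next (go d (suc a) b (trans (sym (+-suc a b)) a+b≡d)))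

≤-triangle : ∀ d → d ≤ triangle d
≤-triangle zero    = z≤n
≤-triangle (suc d) = m≤m+n (suc d) (triangle d)

≤-pair₁ : ∀ a b → a ≤ pair a b
≤-pair₁ a b = ≤-trans (≤-trans (m≤m+n a b) (≤-triangle (a + b))) (m≤m+n _ b)

≤-pair₂ : ∀ a b → b ≤ pair a b
≤-pair₂ a b = m≤n+m b _

<-pair₂ : ∀ a b → b < pair (suc a) b
<-pair₂ a b = +-monoˡ-≤ b (s≤s z≤n)

default : PRF k j
default = Cc Zc []

-- Code n is a node ⟨tag, r⟩, the tag choosing the constructor and r encoding its data; a tag
-- that does not fit the requested arity gives `default`.  The fuel only ensures termination.
mutual
  decode : ℕ → ∀ k j → ℕ → PRF k j
  decode zero    k j n = default
  decode (suc f) k j n = decodeNode f (proj₁ (unpair n)) k j (proj₂ (unpair n))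

  decodeNode : ℕ → ℕ → ∀ k j → ℕ → PRF k j
  decodeNode f 0 0       j       r = Zc
  decodeNode f 1 1       j       r = Sc
  decodeNode f 2 (suc k) j       r = Pc (r mod suc k)
  decodeNode f 3 1       (suc j) r = Ac (r mod suc j)
  decodeNode f 4 k       j       r = let (l , s) = unpair r in
    Cc (decode f l j (proj₁ (unpair s))) (decodeAll f k j l (proj₂ (unpair s)))
  decodeNode f 5 (suc k) j       r =
    Rc (decode f k j (proj₁ (unpair r))) (decode f (suc (suc k)) j (proj₂ (unpair r)))
  decodeNode f _ _       _       _ = default

  decodeAll : ℕ → ∀ k j l → ℕ → Vec (PRF k j) l
  decodeAll f k j zero    n = []
  decodeAll f k j (suc l) n =
    decode f k j (proj₁ (unpair n)) ∷ decodeAll f k j l (proj₂ (unpair n))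

mod-toℕ : ∀ {k} (i : Fin (suc k)) → toℕ i mod suc k ≡ i
mod-toℕ i = toℕ-injective (trans (toℕ-fromℕ< _) (m<n⇒m%n≡m (toℕ<n i)))

DecodedBy : PRF k j → ℕ → Set
DecodedBy {k} {j} e n = ∀ f → n < f → decode f k j n ≡ e

DecodedAllBy : Vec (PRF k j) l → ℕ → Set
DecodedAllBy {k} {j} {l} es n = ∀ f → n < f → decodeAll f k j l n ≡ es

-- A nonzero tag makes r smaller than the node, so the fuel remaining below the node exceeds r.
decodedBy-node : ∀ t r (e : PRF k j) → (∀ f → r < f → decodeNode f (suc t) k j r ≡ e) →
                 DecodedBy e (pair (suc t) r)
decodedBy-node {k} {j} t r e node (suc f) n<1+f =
  trans (cong (λ (t′ , r′) → decodeNode f t′ k j r′) (unpair-pair (suc t) r))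
        (node f (<-≤-trans (<-pair₂ t r) (≤-pred n<1+f)))

mutual
  decode-surjective : (e : PRF k j) → ∃ (DecodedBy e)
  decode-surjective Zc = 0 , λ { (suc f) _ → refl }
  decode-surjective Sc = pair 1 0 , decodedBy-node 0 0 Sc λ _ _ → refl
  decode-surjective {suc k} (Pc i) =
    pair 2 (toℕ i) , decodedBy-node 1 (toℕ i) (Pc i) λ _ _ → cong Pc (mod-toℕ i)
  decode-surjective {j = suc j} (Ac i) =
    pair 3 (toℕ i) , decodedBy-node 2 (toℕ i) (Ac i) λ _ _ → cong Ac (mod-toℕ i)
  decode-surjective {k} {j} (Cc {l = l} g hs) with decode-surjective g | decodeAll-surjective hs
  ... | a , a↦g | b , b↦hs = pair 4 r , decodedBy-node 3 r (Cc g hs) node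
    where
    s = pair a b
    r = pair l s
    node : ∀ f → r < f → decodeNode f 4 k j r ≡ Cc g hs
    node f r<f rewrite unpair-pair l s | unpair-pair a b =
      cong₂ Cc (a↦g f (≤-<-trans (≤-trans (≤-pair₁ a b) (≤-pair₂ l s)) r<f))
               (b↦hs f (≤-<-trans (≤-trans (≤-pair₂ a b) (≤-pair₂ l s)) r<f))
  decode-surjective {suc k} {j} (Rc g h) with decode-surjective g | decode-surjective h
  ... | a , a↦g | b , b↦h = pair 5 r , decodedBy-node 4 r (Rc g h) node
    where
    r = pair a b
    node : ∀ f → r < f → decodeNode f 5 (suc k) j r ≡ Rc g h
    node f r<f rewrite unpair-pair a b =
      cong₂ Rc (a↦g f (≤-<-trans (≤-pair₁ a b) r<f)) (b↦h f (≤-<-trans (≤-pair₂ a b) r<f))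

  decodeAll-surjective : (es : Vec (PRF k j) l) → ∃ (DecodedAllBy es)
  decodeAll-surjective [] = 0 , λ _ _ → refl
  decodeAll-surjective {k} {j} (e ∷ es) with decode-surjective e | decodeAll-surjective es
  ... | a , a↦e | b , b↦es = pair a b , λ f n<f →
    trans (cong (λ (a′ , b′) → decode f k j a′ ∷ decodeAll f k j _ b′) (unpair-pair a b))
          (cong₂ _∷_ (a↦e f (≤-<-trans (≤-pair₁ a b) n<f)) (b↦es f (≤-<-trans (≤-pair₂ a b) n<f)))

enum : ℕ → PRF 1 1
enum x = decode (suc x) 1 1 x

enum-surjective : (e : PRF 1 1) → ∃ λ x → enum x ≡ e
enum-surjective e with decode-surjective e
... | x , x↦e = x , x↦e (suc x) ≤-refl

mutual
  plug : PRF k j → Vec (PRF 1 1) j → PRF k 1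
  plug Zc        ds = Zc
  plug Sc        ds = Sc
  plug (Pc i)    ds = Pc i
  plug (Ac i)    ds = lookup ds i
  plug (Cc g hs) ds = Cc (plug g ds) (plugAll hs ds)
  plug (Rc g h)  ds = Rc (plug g ds) (plug h ds)

  plugAll : Vec (PRF k j) l → Vec (PRF 1 1) j → Vec (PRF k 1) l
  plugAll []       ds = []
  plugAll (h ∷ hs) ds = plug h ds ∷ plugAll hs ds

constant : ℕ → PRF k j
constant zero    = Cc Zc []
constant (suc c) = Cc Sc (constant c ∷ [])

evalAll-constant : (cs : Vec ℕ l) (xs : Vec ℕ k) (fs : Vec (ℕ → ℕ) j) →
                   evalAll (map constant cs) xs fs ≡ cs
evalAll-constant []       xs fs = refl
evalAll-constant (c ∷ cs) xs fs = cong₂ _∷_ (eval-constant c) (evalAll-constant cs xs fs)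
  where
  eval-constant : ∀ c → eval (constant c) xs fs ≡ c
  eval-constant zero    = refl
  eval-constant (suc c) = cong suc (eval-constant c)

Π-cong-⟺ : {A : Set} {P Q : A → Set} → (∀ x → P x ⟺ Q x) → (∀ x → P x) ⟺ (∀ x → Q x)
Π-cong-⟺ P⟺Q = mk⇔ (λ p x → to (P⟺Q x) (p x)) (λ q x → from (P⟺Q x) (q x))

subst₂-⟺ : (R : ℕ → ℕ → Set) {a a′ b b′ : ℕ} → a ≡ a′ → b ≡ b′ → R a b ⟺ R a′ b′
subst₂-⟺ R a≡a′ b≡b′ = mk⇔ (subst₂ R a≡a′ b≡b′) (subst₂ R (sym a≡a′) (sym b≡b′))

-- A function of the model is a code with one function argument, always instantiated by α.
module RecursiveIn (α : ℕ → ℕ) where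

  Code : Set
  Code = PRF 1 1

  fn : Code → ℕ → ℕ
  fn d x = eval d (x ∷ []) (α ∷ [])

  mutual
    ⟦_⟧t : Tm n m → Vector ℕ n → Vector Code m → ℕ
    ⟦ var i      ⟧t ρ η = ρ i
    ⟦ zer        ⟧t ρ η = 0
    ⟦ sc t       ⟧t ρ η = suc (⟦ t ⟧t ρ η)
    ⟦ ap a t     ⟧t ρ η = fn (η a) (⟦ t ⟧t ρ η)
    ⟦ pr f ts as ⟧t ρ η = eval f (⟦ ts ⟧ts ρ η) (map (fn ∘ η) as)

    ⟦_⟧ts : Vec (Tm n m) k → Vector ℕ n → Vector Code m → Vec ℕ k
    ⟦ []     ⟧ts ρ η = []
    ⟦ t ∷ ts ⟧ts ρ η = ⟦ t ⟧t ρ η ∷ ⟦ ts ⟧ts ρ η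

  ⟦_⟧ : Fm n m → Vector ℕ n → Vector Code m → Set
  ⟦ t ≐ u ⟧ ρ η = ⟦ t ⟧t ρ η ≡ ⟦ u ⟧t ρ η
  ⟦ t ≺ u ⟧ ρ η = ⟦ t ⟧t ρ η < ⟦ u ⟧t ρ η
  ⟦ ⊥f    ⟧ ρ η = ⊥
  ⟦ φ ⇒ ψ ⟧ ρ η = ⟦ φ ⟧ ρ η → ⟦ ψ ⟧ ρ η
  ⟦ ∀N φ  ⟧ ρ η = ∀ x → ⟦ φ ⟧ (x ∷ᶠ ρ) η
  ⟦ ∀F φ  ⟧ ρ η = ∀ d → ⟦ φ ⟧ ρ (d ∷ᶠ η)

  mutual
    ⟦subT⟧ : (σ : Fin n → Tm n′ m) {ρ : Vector ℕ n} {ρ′ : Vector ℕ n′} {η : Vector Code m} →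
             (∀ i → ⟦ σ i ⟧t ρ′ η ≡ ρ i) → ∀ t → ⟦ subT σ t ⟧t ρ′ η ≡ ⟦ t ⟧t ρ η
    ⟦subT⟧ σ σ≈ (var i)      = σ≈ i
    ⟦subT⟧ σ σ≈ zer          = refl
    ⟦subT⟧ σ σ≈ (sc t)       = cong suc (⟦subT⟧ σ σ≈ t)
    ⟦subT⟧ σ {η = η} σ≈ (ap a t) = cong (fn (η a)) (⟦subT⟧ σ σ≈ t)
    ⟦subT⟧ σ {η = η} σ≈ (pr f ts as) =
      cong (λ xs → eval f xs (map (fn ∘ η) as)) (⟦subTs⟧ σ σ≈ ts)

    ⟦subTs⟧ : (σ : Fin n → Tm n′ m) {ρ : Vector ℕ n} {ρ′ : Vector ℕ n′} {η : Vector Code m} →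
              (∀ i → ⟦ σ i ⟧t ρ′ η ≡ ρ i) →
              (ts : Vec (Tm n m) k) → ⟦ subTs σ ts ⟧ts ρ′ η ≡ ⟦ ts ⟧ts ρ η
    ⟦subTs⟧ σ σ≈ []       = refl
    ⟦subTs⟧ σ σ≈ (t ∷ ts) = cong₂ _∷_ (⟦subT⟧ σ σ≈ t) (⟦subTs⟧ σ σ≈ ts)

  map-fn-ren : (r : Fin m → Fin m′) {η : Vector Code m′} {η′ : Vector Code m} →
               (∀ a → η (r a) ≡ η′ a) →
               (as : Vec (Fin m) j) → map (fn ∘ η) (map r as) ≡ map (fn ∘ η′) as
  map-fn-ren r {η} r≈ as = trans (sym (map-∘ (fn ∘ η) r as)) (map-cong (λ a → cong fn (r≈ a)) as)

  mutual
    ⟦renFT⟧ : (r : Fin m → Fin m′) {ρ : Vector ℕ n} {η : Vector Code m′} {η′ : Vector Code m} →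
              (∀ a → η (r a) ≡ η′ a) → ∀ t → ⟦ renFT r t ⟧t ρ η ≡ ⟦ t ⟧t ρ η′
    ⟦renFT⟧ r r≈ (var i)      = refl
    ⟦renFT⟧ r r≈ zer          = refl
    ⟦renFT⟧ r r≈ (sc t)       = cong suc (⟦renFT⟧ r r≈ t)
    ⟦renFT⟧ r r≈ (ap a t)     = cong₂ fn (r≈ a) (⟦renFT⟧ r r≈ t)
    ⟦renFT⟧ r {η = η} r≈ (pr f ts as) =
      cong₂ (eval f) (⟦renFTs⟧ r r≈ ts) (map-fn-ren r {η} r≈ as)

    ⟦renFTs⟧ : (r : Fin m → Fin m′) {ρ : Vector ℕ n} {η : Vector Code m′} {η′ : Vector Code m} →
               (∀ a → η (r a) ≡ η′ a) →
               (ts : Vec (Tm n m) k) → ⟦ renFTs r ts ⟧ts ρ η ≡ ⟦ ts ⟧ts ρ η′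
    ⟦renFTs⟧ r r≈ []       = refl
    ⟦renFTs⟧ r r≈ (t ∷ ts) = cong₂ _∷_ (⟦renFT⟧ r r≈ t) (⟦renFTs⟧ r r≈ ts)

  ⟦subF⟧ : (σ : Fin n → Tm n′ m) {ρ : Vector ℕ n} {ρ′ : Vector ℕ n′} {η : Vector Code m} →
           (∀ i → ⟦ σ i ⟧t ρ′ η ≡ ρ i) → ∀ φ → ⟦ subF σ φ ⟧ ρ′ η ⟺ ⟦ φ ⟧ ρ η
  ⟦subF⟧ σ σ≈ (t ≐ u) = subst₂-⟺ _≡_ (⟦subT⟧ σ σ≈ t) (⟦subT⟧ σ σ≈ u)
  ⟦subF⟧ σ σ≈ (t ≺ u) = subst₂-⟺ _<_ (⟦subT⟧ σ σ≈ t) (⟦subT⟧ σ σ≈ u)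
  ⟦subF⟧ σ σ≈ ⊥f      = ⇔-id ⊥
  ⟦subF⟧ σ σ≈ (φ ⇒ ψ) = →-cong-⇔ (⟦subF⟧ σ σ≈ φ) (⟦subF⟧ σ σ≈ ψ)
  ⟦subF⟧ σ {ρ′ = ρ′} σ≈ (∀N φ) = Π-cong-⟺ λ x → ⟦subF⟧ (liftN σ) (lifted x) φ
    where
    lifted : ∀ x i → ⟦ liftN σ i ⟧t (x ∷ᶠ ρ′) _ ≡ (x ∷ᶠ _) i
    lifted x zero    = refl
    lifted x (suc i) = trans (⟦subT⟧ (λ i → var (suc i)) (λ _ → refl) (σ i)) (σ≈ i)
  ⟦subF⟧ σ σ≈ (∀F φ) = Π-cong-⟺ λ d →
    ⟦subF⟧ (renFT suc ∘ σ) (λ i → trans (⟦renFT⟧ suc (λ _ → refl) (σ i)) (σ≈ i)) φ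

  ⟦renF⟧ : (r : Fin m → Fin m′) {ρ : Vector ℕ n} {η : Vector Code m′} {η′ : Vector Code m} →
           (∀ a → η (r a) ≡ η′ a) → ∀ φ → ⟦ renF r φ ⟧ ρ η ⟺ ⟦ φ ⟧ ρ η′
  ⟦renF⟧ r r≈ (t ≐ u) = subst₂-⟺ _≡_ (⟦renFT⟧ r r≈ t) (⟦renFT⟧ r r≈ u)
  ⟦renF⟧ r r≈ (t ≺ u) = subst₂-⟺ _<_ (⟦renFT⟧ r r≈ t) (⟦renFT⟧ r r≈ u)
  ⟦renF⟧ r r≈ ⊥f      = ⇔-id ⊥
  ⟦renF⟧ r r≈ (φ ⇒ ψ) = →-cong-⇔ (⟦renF⟧ r r≈ φ) (⟦renF⟧ r r≈ ψ)
  ⟦renF⟧ r r≈ (∀N φ)  = Π-cong-⟺ λ x → ⟦renF⟧ r r≈ φ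
  ⟦renF⟧ r {η = η} {η′} r≈ (∀F φ) = Π-cong-⟺ λ d → ⟦renF⟧ (liftF r) (lifted d) φ
    where
    lifted : ∀ d a → (d ∷ᶠ η) (liftF r a) ≡ (d ∷ᶠ η′) a
    lifted d zero    = refl
    lifted d (suc a) = r≈ a

  -- Formulas use only =, <, ⊥, ⇒ and ∀, so their meanings are ¬¬-stable and DN is sound.
  ⟦⟧-stable : ∀ (φ : Fm n m) {ρ η} → ¬ ¬ ⟦ φ ⟧ ρ η → ⟦ φ ⟧ ρ η
  ⟦⟧-stable (t ≐ u) {ρ} {η} = decidable-stable (⟦ t ⟧t ρ η ≟ ⟦ u ⟧t ρ η)
  ⟦⟧-stable (t ≺ u) {ρ} {η} = decidable-stable (⟦ t ⟧t ρ η <? ⟦ u ⟧t ρ η)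
  ⟦⟧-stable ⊥f      ¬¬⊥    = ¬¬⊥ id
  ⟦⟧-stable (φ ⇒ ψ) ¬¬f a = ⟦⟧-stable ψ λ ¬b → ¬¬f λ f → ¬b (f a)
  ⟦⟧-stable (∀N φ)  ¬¬f x = ⟦⟧-stable φ λ ¬b → ¬¬f λ f → ¬b (f x)
  ⟦⟧-stable (∀F φ)  ¬¬f d = ⟦⟧-stable φ λ ¬b → ¬¬f λ f → ¬b (f d)

  ⟦∧f⟧-intro : ∀ (φ ψ : Fm n m) {ρ η} → ⟦ φ ⟧ ρ η → ⟦ ψ ⟧ ρ η → ⟦ φ ∧f ψ ⟧ ρ η
  ⟦∧f⟧-intro φ ψ a b a⇒¬b = a⇒¬b a b

  ⟦∧f⟧-elim : ∀ (φ ψ : Fm n m) {ρ η} → ⟦ φ ∧f ψ ⟧ ρ η → ⟦ φ ⟧ ρ η × ⟦ ψ ⟧ ρ η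
  ⟦∧f⟧-elim φ ψ a∧b =
    ⟦⟧-stable φ (λ ¬a → a∧b λ a _ → ¬a a) , ⟦⟧-stable ψ (λ ¬b → a∧b λ _ b → ¬b b)

  ⟦∃F⟧-intro : ∀ (φ : Fm n (suc m)) {ρ η} d → ⟦ φ ⟧ ρ (d ∷ᶠ η) → ⟦ ∃F φ ⟧ ρ η
  ⟦∃F⟧-intro φ d a ∀¬a = ∀¬a d a

  lookup-⟦⟧ts : ∀ (ts : Vec (Tm n m) k) i {ρ η} → lookup (⟦ ts ⟧ts ρ η) i ≡ ⟦ lookup ts i ⟧t ρ η
  lookup-⟦⟧ts (t ∷ ts) zero    = refl
  lookup-⟦⟧ts (t ∷ ts) (suc i) = lookup-⟦⟧ts ts i

  ⟦/N0⟧ : ∀ (t : Tm n m) {ρ η} i → ⟦ (t /N0) i ⟧t ρ η ≡ (⟦ t ⟧t ρ η ∷ᶠ ρ) i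
  ⟦/N0⟧ t zero    = refl
  ⟦/N0⟧ t (suc i) = refl

  Ind-valid : ∀ (φ : Fm (suc n) m) {ρ η} → ⟦ Ind φ ⟧ ρ η
  Ind-valid φ {ρ} {η} base step = go
    where
    at-succ : ∀ x i → ⟦ succ/0 i ⟧t (x ∷ᶠ ρ) η ≡ (suc x ∷ᶠ ρ) i
    at-succ x zero    = refl
    at-succ x (suc i) = refl

    go : ∀ x → ⟦ φ ⟧ (x ∷ᶠ ρ) η
    go zero    = to (⟦subF⟧ zero/0 (⟦/N0⟧ zer) φ) base
    go (suc x) = to (⟦subF⟧ succ/0 (at-succ x) φ) (step x (go x))

  ⟦pr-map⟧ : ∀ (hs : Vec (PRF k j) l) (ts : Vec (Tm n m) k) as {ρ η} →
             ⟦ map (λ h → pr h ts as) hs ⟧ts ρ η ≡ evalAll hs (⟦ ts ⟧ts ρ η) (map (fn ∘ η) as)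
  ⟦pr-map⟧ []       ts as = refl
  ⟦pr-map⟧ (h ∷ hs) ts as = cong (_ ∷_) (⟦pr-map⟧ hs ts as)

  mutual
    eval-plug : (f : PRF k j) (ds : Vec Code j) (xs : Vec ℕ k) →
                eval (plug f ds) xs (α ∷ []) ≡ eval f xs (map fn ds)
    eval-plug Zc        ds []       = refl
    eval-plug Sc        ds (x ∷ []) = refl
    eval-plug (Pc i)    ds xs       = refl
    eval-plug (Ac i)    ds (x ∷ []) = sym (cong (λ g → g x) (lookup-map i fn ds))
    eval-plug (Cc g hs) ds xs       =
      trans (cong (λ ys → eval (plug g ds) ys (α ∷ [])) (evalAll-plugAll hs ds xs)) (eval-plug g ds _)
    eval-plug (Rc g h)  ds (x ∷ xs) = evalRec-plug g h ds x xs

    evalRec-plug : (g : PRF k j) (h : PRF (suc (suc k)) j) (ds : Vec Code j) (x : ℕ) (xs : Vec ℕ k) →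
                   evalRec (plug g ds) (plug h ds) x xs (α ∷ []) ≡ evalRec g h x xs (map fn ds)
    evalRec-plug g h ds zero    xs = eval-plug g ds xs
    evalRec-plug g h ds (suc x) xs =
      trans (cong (λ r → eval (plug h ds) (x ∷ r ∷ xs) (α ∷ [])) (evalRec-plug g h ds x xs))
            (eval-plug h ds _)

    evalAll-plugAll : (hs : Vec (PRF k j) l) (ds : Vec Code j) (xs : Vec ℕ k) →
                      evalAll (plugAll hs ds) xs (α ∷ []) ≡ evalAll hs xs (map fn ds)
    evalAll-plugAll []       ds xs = refl
    evalAll-plugAll (h ∷ hs) ds xs = cong₂ _∷_ (eval-plug h ds xs) (evalAll-plugAll hs ds xs)

  <-suc-⟺ : ∀ a b → a < suc b ⟺ (¬ a < b → a ≡ b)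
  <-suc-⟺ a b = mk⇔ split join
    where
    split : a < suc b → ¬ a < b → a ≡ b
    split a<1+b a≮b with m<1+n⇒m<n∨m≡n a<1+b
    ... | inj₁ a<b = ⊥-elim (a≮b a<b)
    ... | inj₂ a≡b = a≡b
    join : (¬ a < b → a ≡ b) → a < suc b
    join a≡b with a <? b
    ... | yes a<b = m<n⇒m<1+n a<b
    ... | no  a≮b = subst (λ c → a < suc c) (a≡b a≮b) (n<1+n a)

  axiom-valid : ∀ {φ : Fm n m} → PRA²+IΣ⁰₁ φ → ∀ {ρ η} → ⟦ φ ⟧ ρ η
  axiom-valid (succ≠0 t)       ()
  axiom-valid (succ-inj t u)   = suc-injective
  axiom-valid (lt-zero t)      ()
  axiom-valid (lt-succ t u)    = ⟦∧f⟧-intro (t ≺ sc u ⇒ t ≺ u ∨f t ≐ u) (t ≺ u ∨f t ≐ u ⇒ t ≺ sc u)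
                                            (to (<-suc-⟺ _ _)) (from (<-suc-⟺ _ _))
  axiom-valid (eq-Z as)        = refl
  axiom-valid (eq-S t as)      = refl
  axiom-valid (eq-P i ts as)   = lookup-⟦⟧ts ts i
  axiom-valid (eq-A i t as) {ρ} {η} = cong (λ g → g (⟦ t ⟧t ρ η)) (lookup-map i (fn ∘ η) as)
  axiom-valid (eq-C g hs ts as) {ρ} {η} =
    cong (λ ys → eval g ys (map (fn ∘ η) as)) (sym (⟦pr-map⟧ hs ts as))
  axiom-valid (eq-R0 g h ts as) = refl
  axiom-valid (eq-RS g h t ts as) = refl
  axiom-valid (fun-closure f ts as) {ρ} {η} =
    ⟦∃F⟧-intro (∀N (ap zero (var zero) ≐ pr f (var zero ∷ wkNTs (renFTs suc ts)) (map suc as))) code λ x →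
    begin
      eval (plug f ds) (x ∷ evalAll (map constant vs) (x ∷ []) (α ∷ [])) (α ∷ [])
    ≡⟨ cong (λ ys → eval (plug f ds) (x ∷ ys) (α ∷ [])) (evalAll-constant vs (x ∷ []) (α ∷ [])) ⟩
      eval (plug f ds) (x ∷ vs) (α ∷ [])
    ≡⟨ eval-plug f ds (x ∷ vs) ⟩
      eval f (x ∷ vs) (map fn ds)
    ≡⟨ sym (cong₂ (λ ys gs → eval f (x ∷ ys) gs) (weakened x) shifted) ⟩
      ⟦ pr f (var zero ∷ wkNTs (renFTs suc ts)) (map suc as) ⟧t (x ∷ᶠ ρ) (code ∷ᶠ η)
    ∎
    where
    open ≡-Reasoning
    vs = ⟦ ts ⟧ts ρ η
    ds = map η as
    -- λx. f(x, ts, as) as one code: the function arguments become the codes η(as), the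
    -- parameters ts become constants.
    code : Code
    code = Cc (plug f ds) (Pc zero ∷ map constant vs)
    weakened : ∀ x → ⟦ wkNTs (renFTs suc ts) ⟧ts (x ∷ᶠ ρ) (code ∷ᶠ η) ≡ vs
    weakened x = trans (⟦subTs⟧ (λ i → var (suc i)) (λ _ → refl) (renFTs suc ts))
                       (⟦renFTs⟧ suc (λ _ → refl) ts)
    shifted : map (fn ∘ (code ∷ᶠ η)) (map suc as) ≡ map fn ds
    shifted = trans (map-fn-ren suc {code ∷ᶠ η} (λ _ → refl) as) (map-∘ fn η as)
  axiom-valid (qf-ind {φ = φ} _)  = Ind-valid φ
  axiom-valid (Σ⁰₁-ind {φ = φ} _) = Ind-valid φ

  sound : ∀ {φ : Fm n m} → PRA²+IΣ⁰₁ ⊢ φ → ∀ {ρ η} → ⟦ φ ⟧ ρ η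
  sound (ax a)               = axiom-valid a
  sound K                    = λ a _ → a
  sound S                    = λ f g a → f a (g a)
  sound (DN {φ = φ})         = ⟦⟧-stable φ
  sound (mp d e)             = sound d (sound e)
  sound (∀N-elim {φ = φ} t)  = λ ∀φ → from (⟦subF⟧ (t /N0) (⟦/N0⟧ t) φ) (∀φ _)
  sound (∀N-intro {ψ = ψ} d) = λ ψ′ x → sound d (from (⟦subF⟧ (λ i → var (suc i)) (λ _ → refl) ψ) ψ′)
  sound (∀F-elim {φ = φ} a) {η = η} = λ ∀φ → from (⟦renF⟧ (a /F0) instantiated φ) (∀φ (η a))
    where
    instantiated : ∀ b → η ((a /F0) b) ≡ (η a ∷ᶠ η) b
    instantiated zero    = refl
    instantiated (suc b) = refl
  sound (∀F-intro {ψ = ψ} d) = λ ψ′ e → sound d (from (⟦renF⟧ suc (λ _ → refl) ψ) ψ′)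
  sound (eq-refl t)          = refl
  sound (eq-subst {φ = φ} t u) {ρ} {η} = λ t≡u φt →
    from (⟦subF⟧ (u /N0) (⟦/N0⟧ u) φ)
      (subst (λ v → ⟦ φ ⟧ (v ∷ᶠ ρ) η) t≡u (to (⟦subF⟧ (t /N0) (⟦/N0⟧ t) φ) φt))

-- A finished run of enum x on x is recorded as 2x+1 (result 0) or 2x+2 (nonzero result);
-- an unfinished one as 0, which records nothing.
verdict : ℕ → Maybe ℕ → ℕ
verdict x nothing        = 0
verdict x (just zero)    = suc (2 * x)
verdict x (just (suc _)) = 2 * suc x

runDiag : ℕ → PartialOracle → Maybe ℕ
runDiag x = evalPartial (enum x) (x ∷ [])

target : ℕ → ℕ
target n = proj₁ (unpair n)

stage : ℕ → PartialOracle → ℕ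
stage n o = verdict (target n) (runDiag (target n) o)

approx : ℕ → PartialOracle
approx zero    m = nothing
approx (suc n) m with <-cmp m n
... | tri< _ _ _ = approx n m
... | tri≈ _ _ _ = just (stage n (approx n))
... | tri> _ _ _ = nothing

α : ℕ → ℕ
α n = stage n (approx n)

approx-defined : ∀ n → DefinedBelow α n (approx n)
approx-defined (suc n) {m} m<1+n with <-cmp m n
... | tri< m<n _ _  = approx-defined n m<n
... | tri≈ _ refl _ = refl
... | tri> _ _ n<m  = ⊥-elim (<⇒≱ n<m (≤-pred m<1+n))

approx-domain : ∀ n {m w} → approx n m ≡ just w → m < n
approx-domain (suc n) {m} defined with <-cmp m n
... | tri< _ _ _    = m<n⇒m<1+n (approx-domain n defined)
... | tri≈ _ refl _ = ≤-refl

approx-approximates : ∀ n → Approximates α (approx n)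
approx-approximates n defined =
  just-injective (trans (sym (approx-defined n (approx-domain n defined))) defined)

open RecursiveIn α

diag : ℕ → ℕ
diag x = fn (enum x) x

runDiag-sound : ∀ n {v} → runDiag (target n) (approx n) ≡ just v → diag (target n) ≡ v
runDiag-sound n = evalPartial-sound α {o = approx n} (approx-approximates n) (enum (target n)) (target n ∷ [])

-- Stage ⟨x, M⟩, where M bounds the oracle queries of the run of enum x on x, records its result.
α-records : ∀ x → ∃ λ n → α n ≡ verdict x (just (diag x))
α-records x with evalPartial-use α (enum x) (x ∷ [])
... | M , use = pair x M , (begin
  α (pair x M)                                  ≡⟨ cong (λ y → verdict y (runDiag y (approx (pair x M))))
                                                        (cong proj₁ (unpair-pair x M)) ⟩
  verdict x (runDiag x (approx (pair x M)))     ≡⟨ cong (verdict x) (use λ m<M →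
                                                     approx-defined _ (<-≤-trans m<M (≤-pair₂ x M))) ⟩
  verdict x (just (diag x))                     ∎)
  where open ≡-Reasoning

verdict-odd : ∀ y r {x} → verdict y r ≡ suc (2 * x) → y ≡ x × r ≡ just 0
verdict-odd y (just zero)    {x} e = *-cancelˡ-≡ y x 2 (suc-injective e) , refl
verdict-odd y (just (suc v)) {x} e = ⊥-elim (even≢odd (suc y) x e)

verdict-even : ∀ y r {x} → verdict y r ≡ 2 * suc x → y ≡ x × ∃ λ v → r ≡ just (suc v)
verdict-even y (just zero)    {x} e = ⊥-elim (even≢odd (suc x) y (sym e))
verdict-even y (just (suc v)) {x} e = suc-injective (*-cancelˡ-≡ (suc y) (suc x) 2 e) , v , refl

α-odd : ∀ n {x} → α n ≡ suc (2 * x) → diag x ≡ 0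
α-odd n {x} e with verdict-odd (target n) (runDiag (target n) (approx n)) {x} e
... | y≡x , run≡0 = subst (λ y → diag y ≡ 0) y≡x (runDiag-sound n run≡0)

α-even : ∀ n {x} → α n ≡ 2 * suc x → diag x ≢ 0
α-even n {x} e diag-x≡0 with verdict-even (target n) (runDiag (target n) (approx n)) {x} e
... | y≡x , v , run≡1+v =
  0≢1+n (trans (sym diag-x≡0) (subst (λ y → diag y ≡ suc v) y≡x (runDiag-sound n run≡1+v)))

no-characteristic-function : ∀ d → ¬ (∀ x → (diag x ≡ 0 → fn d x ≡ 1) × (diag x ≢ 0 → fn d x ≡ 0))
no-characteristic-function d χ with enum-surjective d
... | x , enum-x≡d with χ x | diag x ≟ 0
...   | if∈ , _ | yes diag-x≡0 =
  0≢1+n (trans (sym diag-x≡0) (trans (cong (λ e → fn e x) enum-x≡d) (if∈ diag-x≡0)))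
...   | _ , if∉ | no  diag-x≢0 = diag-x≢0 (trans (cong (λ e → fn e x) enum-x≡d) (if∉ diag-x≢0))

double : PRF 1 0
double = Rc Zc (Cc Sc (Cc Sc (Pc (suc zero) ∷ []) ∷ []))

eval-double : ∀ x → eval double (x ∷ []) [] ≡ 2 * x
eval-double zero    = refl
eval-double (suc x) = trans (cong (λ v → suc (suc v)) (eval-double x)) (cong suc (sym (+-suc x (x + 0))))

diagΣ₁ : Fm 1 1
diagΣ₁ = ∃N (ap zero (var zero) ≐ sc (pr double (var (suc zero) ∷ []) []))

diagΠ₁ : Fm 1 1
diagΠ₁ = ∀N (¬f (ap zero (var zero) ≐ pr double (sc (var (suc zero)) ∷ []) []))

oracle : Vector Code 1
oracle _ = Ac zero

diagΣ₁-meaning : ∀ x → ⟦ diagΣ₁ ⟧ (x ∷ᶠ []ᶠ) oracle ⟺ diag x ≡ 0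
diagΣ₁-meaning x = mk⇔
  (λ ¬¬odd → decidable-stable (diag x ≟ 0) λ diag-x≢0 →
     ¬¬odd λ n αn≡ → diag-x≢0 (α-odd n {x} (trans αn≡ (cong suc (eval-double x)))))
  (λ diag-x≡0 ¬odd → let (n , αn≡) = α-records x in
     ¬odd n (trans αn≡ (trans (cong (verdict x ∘ just) diag-x≡0) (cong suc (sym (eval-double x))))))

diagΠ₁-meaning : ∀ x → ⟦ diagΠ₁ ⟧ (x ∷ᶠ []ᶠ) oracle ⟺ diag x ≡ 0
diagΠ₁-meaning x = mk⇔
  (λ ¬even → decidable-stable (diag x ≟ 0) λ diag-x≢0 → let (n , αn≡) = α-records x in
     ¬even n (trans αn≡ (trans (verdict-nonzero diag-x≢0) (sym (eval-double (suc x))))))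
  (λ diag-x≡0 n αn≡ → α-even n {x} (trans αn≡ (eval-double (suc x))) diag-x≡0)
  where
  verdict-nonzero : ∀ {v} → v ≢ 0 → verdict x (just v) ≡ 2 * suc x
  verdict-nonzero {zero}  0≢0 = ⊥-elim (0≢0 refl)
  verdict-nonzero {suc v} _   = refl

Δ⁰₁-CA-fails : ¬ ⟦ Δ⁰₁-CA diagΣ₁ diagΠ₁ ⟧ []ᶠ oracle
Δ⁰₁-CA-fails CA = CA equivalent λ d χ → no-characteristic-function d λ x →
  let (if∈ , if∉) = ⟦∧f⟧-elim (wkF diagΣ₁ ⇒ ap zero (var zero) ≐ one) (¬f wkF diagΣ₁ ⇒ ap zero (var zero) ≐ zer)
                              {x ∷ᶠ []ᶠ} {d ∷ᶠ oracle} (χ x)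
  in if∈ ∘ from (diagΣ₁-meaning x) , if∉ ∘ λ diag-x≢0 → diag-x≢0 ∘ to (diagΣ₁-meaning x)
  where
  equivalent : ⟦ ∀N (diagΣ₁ ⇔ diagΠ₁) ⟧ []ᶠ oracle
  equivalent x = ⟦∧f⟧-intro (diagΣ₁ ⇒ diagΠ₁) (diagΠ₁ ⇒ diagΣ₁) {x ∷ᶠ []ᶠ} {oracle}
    (from (diagΠ₁-meaning x) ∘ to (diagΣ₁-meaning x)) (from (diagΣ₁-meaning x) ∘ to (diagΠ₁-meaning x))

mainTheorem18 : ¬ (∀ {n m} (φ ψ : Fm (suc n) m) → Σ⁰₁ φ → Π⁰₁ ψ → PRA²+IΣ⁰₁ ⊢ Δ⁰₁-CA φ ψ)
mainTheorem18 CA = Δ⁰₁-CA-fails (sound (CA diagΣ₁ diagΠ₁ (sig (d-eq _ _)) (pi (d-imp (d-eq _ _) d-⊥))) {[]ᶠ} {oracle})
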